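{- Let $\mathcal{M}$ be a $4$-divisible multiset of points in $\mathrm{PG}(v-1,2)$ with cardinality $12$. Then either there exists a point with multiplicity at least four, or all points have even multiplicity.
   Context: $\mathrm{PG}(v-1,2)$ is the projective geometry of $\mathbb{F}_2^v$; points and hyperplanes are subspaces of dimension $1$ and $v-1$. A multiset of points $\mathcal{M}$ assigns to each point $P$ a multiplicity $\mathcal{M}(P)\in\{0,1,2,\dots\}$; $\mathcal{M}(K)=\sum_{P\le K}\mathcal{M}(P)$ for a subspace $K$, and $\#\mathcal{M}=\mathcal{M}(\mathbb{F}_2^v)$. $\mathcal{M}$ is $\Delta$-divisible if $\mathcal{M}(H)\equiv\#\mathcal{M}\pmod\Delta$ for every hyperplane $H$. -}

module Defs where

open import Data.Bool using (Bool; true; false; _xor_; _∧_; not; if_then_else_) renaming (_≟_ to _≟ᵇ_)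
open import Data.Nat using (ℕ; zero; suc; _+_; _≥_; NonZero)
open import Data.Nat.DivMod using (_%_)
open import Data.List using (List; []; _∷_; map; _++_; filter)
open import Data.Nat.ListAction using (sum)
open import Data.Vec using (Vec; []; _∷_)
open import Data.Product using (Σ; _×_)
open import Relation.Binary.PropositionalEquality using (_≡_)

Vect : ℕ → Set
Vect v = Vec Bool v

allVecs : (v : ℕ) → List (Vect v)
allVecs zero = [] ∷ []
allVecs (suc v) = map (false ∷_) (allVecs v) ++ map (true ∷_) (allVecs v)

nonzero : ∀ {v} → Vect v → Bool
nonzero [] = false
nonzero (b ∷ x) = if b then true else nonzero x

-- Points of PG(v-1,2): over F_2, each 1-dim subspace <x> has exactly one
-- nonzero vector x, so points are identified with nonzero vectors.
IsPoint : ∀ {v} → Vect v → Set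
IsPoint x = nonzero x ≡ true

dot : ∀ {v} → Vect v → Vect v → Bool
dot [] [] = false
dot (a ∷ as) (b ∷ bs) = (a ∧ b) xor dot as bs

-- A multiset of points: multiplicity function. Its value on the zero
-- vector is irrelevant (never summed / never counts as a point).
Multiset : ℕ → Set
Multiset v = Vect v → ℕ

card : ∀ {v} → Multiset v → ℕ
card {v} M = sum (map M (filter (λ x → nonzero x ≟ᵇ true) (allVecs v)))

-- Hyperplanes of PG(v-1,2) are exactly the kernels a^⊥ = {x | a·x = 0}
-- for nonzero a (each hyperplane arises from a unique nonzero a).
-- M(a^⊥) = sum of multiplicities of points lying in a^⊥.
hypMass : ∀ {v} → Multiset v → Vect v → ℕ
hypMass {v} M a =
  sum (map M (filter (λ x → (nonzero x ∧ not (dot a x)) ≟ᵇ true) (allVecs v)))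

Divisible : ∀ {v} → (Δ : ℕ) → .{{_ : NonZero Δ}} → Multiset v → Set
Divisible {v} Δ M = (a : Vect v) → IsPoint a → hypMass M a % Δ ≡ card M % Δ

Even : ℕ → Set
Even n = n % 2 ≡ 0

module Submission where

-- If some point has multiplicity at least four we are done, so let all multiplicities be at most
-- three and write M = A + 2B with A, B 0/1-valued, n = |A|, k = |B|, n + 2k = 12. For a ≠ 0 let
-- p, q be the masses of A, B off the hyperplane a⊥; 4-divisibility says 4 ∣ p + 2q. The Fourier
-- transforms over F₂ᵛ are s(a) = n − 2p and t(a) = k − 2q, and for β the sum of the support of B,
-- σ(a) = (−1)^(a·β) = (−1)^q. For each k ≤ 5 the finitely many admissible (p, q) satisfy a
-- polynomial relation in s, t, σ which, summed over all a using Parseval (∑ s² = 2ᵛ n), inversion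
-- (∑ σ s = 2ᵛ A(β)) and positive definiteness (∑ σ ≥ 0, ∑ σ s³ ≥ 0), gives a contradiction.
-- Hence k = 6 and n = 0, i.e. every multiplicity is even.

open import Algebra.Bundles using (CommutativeSemiring)
open import Data.List using (List; []; _∷_; map; _++_)
open import Level using (Level)

module ListSum {c ℓ} (R : CommutativeSemiring c ℓ) where

  open CommutativeSemiring R
  open import Relation.Binary.Reasoning.Setoid setoid

  private variable
    a : Level
    A B : Set a

  ∑ : List A → (A → Carrier) → Carrier
  ∑ []       f = 0#
  ∑ (x ∷ xs) f = f x + ∑ xs f

  ∑-cong : ∀ (xs : List A) {f g : A → Carrier} → (∀ x → f x ≈ g x) → ∑ xs f ≈ ∑ xs g
  ∑-cong []       f≈g = refl
  ∑-cong (x ∷ xs) f≈g = +-cong (f≈g x) (∑-cong xs f≈g)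

  ∑-++ : ∀ (xs ys : List A) (f : A → Carrier) → ∑ (xs ++ ys) f ≈ ∑ xs f + ∑ ys f
  ∑-++ []       ys f = sym (+-identityˡ _)
  ∑-++ (x ∷ xs) ys f = trans (+-congˡ (∑-++ xs ys f)) (sym (+-assoc _ _ _))

  ∑-map : ∀ (h : A → B) (xs : List A) (f : B → Carrier) → ∑ (map h xs) f ≈ ∑ xs (λ x → f (h x))
  ∑-map h []       f = refl
  ∑-map h (x ∷ xs) f = +-congˡ (∑-map h xs f)

  ∑-zero : ∀ (xs : List A) → ∑ xs (λ _ → 0#) ≈ 0#
  ∑-zero []       = refl
  ∑-zero (x ∷ xs) = trans (+-identityˡ _) (∑-zero xs)

  ∑-distrib-+ : ∀ (xs : List A) (f g : A → Carrier) → ∑ xs (λ x → f x + g x) ≈ ∑ xs f + ∑ xs g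
  ∑-distrib-+ []       f g = sym (+-identityˡ 0#)
  ∑-distrib-+ (x ∷ xs) f g = begin
    (f x + g x) + ∑ xs (λ x → f x + g x) ≈⟨ +-congˡ (∑-distrib-+ xs f g) ⟩
    (f x + g x) + (∑ xs f + ∑ xs g)      ≈⟨ interchange (f x) (g x) _ _ ⟩
    (f x + ∑ xs f) + (g x + ∑ xs g)      ∎
    where open import Algebra.Properties.CommutativeSemigroup +-commutativeSemigroup using (interchange)

  ∑-distribˡ-* : ∀ (xs : List A) (c : Carrier) (f : A → Carrier) → ∑ xs (λ x → c * f x) ≈ c * ∑ xs f
  ∑-distribˡ-* []       c f = sym (zeroʳ c)
  ∑-distribˡ-* (x ∷ xs) c f = trans (+-congˡ (∑-distribˡ-* xs c f)) (sym (distribˡ c _ _))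

  ∑-linear : ∀ (xs : List A) (c : Carrier) (f g : A → Carrier) →
             ∑ xs (λ x → c * f x + g x) ≈ c * ∑ xs f + ∑ xs g
  ∑-linear xs c f g = trans (∑-distrib-+ xs _ g) (+-congʳ (∑-distribˡ-* xs c f))

  ∑-comm : ∀ (xs : List A) (ys : List B) (F : A → B → Carrier) →
           ∑ xs (λ x → ∑ ys (F x)) ≈ ∑ ys (λ y → ∑ xs (λ x → F x y))
  ∑-comm []       ys F = sym (∑-zero ys)
  ∑-comm (x ∷ xs) ys F = begin
    ∑ ys (F x) + ∑ xs (λ x → ∑ ys (F x))        ≈⟨ +-congˡ (∑-comm xs ys F) ⟩
    ∑ ys (F x) + ∑ ys (λ y → ∑ xs (λ x → F x y)) ≈⟨ sym (∑-distrib-+ ys (F x) _) ⟩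
    ∑ ys (λ y → F x y + ∑ xs (λ x → F x y))      ∎

open import Algebra.Bundles using (CommutativeRing)
open import Data.Bool using (Bool; true; false; not; _∧_; _xor_; if_then_else_) renaming (_≟_ to _≟ᵇ_)
open import Data.Bool.Properties using (∧-comm; ∧-distribˡ-xor; xor-∧-commutativeRing)
open import Data.Empty using (⊥; ⊥-elim)
open import Data.Fin using (Fin; toℕ; fromℕ<)
open import Data.Fin.Properties using (all?; toℕ-fromℕ<)
open import Data.Integer as ℤ using (ℤ; +_; 0ℤ; 1ℤ; -1ℤ; -_; _*_; _+_; _-_; _≤_; +≤+)
import Data.Integer.Properties as ℤ
open import Data.Integer.Tactic.RingSolver using (solve-∀)
open import Data.List using (filter)
open import Data.List.Membership.Propositional using (_∈_; lose)
open import Data.List.Membership.Propositional.Properties using (∈-map⁺; ∈-++⁺ˡ; ∈-++⁺ʳ)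
open import Data.List.Relation.Unary.Any as Any using (here; there)
open import Data.Nat as ℕ using (ℕ; zero; suc; _^_; _≥_)
open import Data.Nat.DivMod using (_%_; _/_; m≡m%n+[m/n]*n; m%n<n; /-monoˡ-≤)
open import Data.Nat.Divisibility using (_∣_; _∣?_; divides; _∣0; m%n≡0⇒n∣m; ∣m+n∣m⇒∣n)
open import Data.Nat.ListAction using (sum)
import Data.Nat.Properties as ℕ
open import Data.Product using (Σ; _×_; _,_)
open import Data.Sum using (_⊎_; inj₁; inj₂; map₂)
open import Data.Vec using ([]; _∷_; replicate; zipWith)
open import Defs
open import Function using (_∘_)
open import Relation.Binary.PropositionalEquality
open import Relation.Nullary using (¬_; yes; no)
open import Relation.Nullary.Decidable using (Dec; True; toWitness; _→-dec_; _×-dec_)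
open ≡-Reasoning

open import Algebra.Properties.CommutativeSemigroup
  (CommutativeRing.+-commutativeSemigroup xor-∧-commutativeRing) using () renaming (interchange to xor-interchange)

module ℕΣ = ListSum ℕ.+-*-commutativeSemiring
open ListSum ℤ.+-*-commutativeSemiring

∑-neg : ∀ {a} {A : Set a} (xs : List A) (f : A → ℤ) → ∑ xs (λ x → - f x) ≡ - ∑ xs f
∑-neg xs f = begin
  ∑ xs (λ x → - f x)      ≡⟨ ∑-cong xs (λ x → sym (ℤ.-1*i≡-i (f x))) ⟩
  ∑ xs (λ x → -1ℤ * f x)  ≡⟨ ∑-distribˡ-* xs -1ℤ f ⟩
  -1ℤ * ∑ xs f            ≡⟨ ℤ.-1*i≡-i (∑ xs f) ⟩
  - ∑ xs f                ∎

∑-*-zeroʳ : ∀ {a} {A : Set a} (xs : List A) (g : A → ℤ) → ∑ xs (λ y → g y * 0ℤ) ≡ 0ℤ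
∑-*-zeroʳ xs g = trans (∑-cong xs (λ y → ℤ.*-zeroʳ (g y))) (∑-zero xs)

∑-nonNeg : ∀ {a} {A : Set a} (xs : List A) {f : A → ℤ} → (∀ x → 0ℤ ≤ f x) → 0ℤ ≤ ∑ xs f
∑-nonNeg []       f≥0 = ℤ.≤-refl
∑-nonNeg (x ∷ xs) f≥0 = ℤ.+-mono-≤ (f≥0 x) (∑-nonNeg xs f≥0)

*-nonNeg : ∀ {i j} → 0ℤ ≤ i → 0ℤ ≤ j → 0ℤ ≤ i * j
*-nonNeg {+ m} {+ n} _ _ = subst (0ℤ ≤_) (ℤ.pos-* m n) (+≤+ ℕ.z≤n)

term≤∑ : ∀ {a} {A : Set a} {xs : List A} {f : A → ℤ} {x : A} → x ∈ xs → (∀ y → 0ℤ ≤ f y) → f x ≤ ∑ xs f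
term≤∑ {xs = _ ∷ xs} (here refl) f≥0 = ℤ.i≤i+j _ _ {{ℤ.nonNegative (∑-nonNeg xs f≥0)}}
term≤∑ {xs = y ∷ _} (there x∈xs) f≥0 = ℤ.i≤j⇒i≤k+j _ {{ℤ.nonNegative (f≥0 y)}} (term≤∑ x∈xs f≥0)

pos-∑ : ∀ {a} {A : Set a} (xs : List A) (f : A → ℕ) → + ℕΣ.∑ xs f ≡ ∑ xs (λ x → + f x)
pos-∑ []       f = refl
pos-∑ (x ∷ xs) f = trans (ℤ.pos-+ (f x) (ℕΣ.∑ xs f)) (cong (_+_ (+ f x)) (pos-∑ xs f))

∑ℕ-mono-≤ : ∀ {a} {A : Set a} (xs : List A) {f g : A → ℕ} → (∀ x → f x ℕ.≤ g x) → ℕΣ.∑ xs f ℕ.≤ ℕΣ.∑ xs g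
∑ℕ-mono-≤ []       f≤g = ℕ.z≤n
∑ℕ-mono-≤ (x ∷ xs) f≤g = ℕ.+-mono-≤ (f≤g x) (∑ℕ-mono-≤ xs f≤g)

∑ℕ≡0⇒≡0 : ∀ {a} {A : Set a} {xs : List A} {f : A → ℕ} {x : A} → ℕΣ.∑ xs f ≡ 0 → x ∈ xs → f x ≡ 0
∑ℕ≡0⇒≡0 {xs = y ∷ _} {f} ∑≡0 (here refl)  = ℕ.m+n≡0⇒m≡0 (f y) ∑≡0
∑ℕ≡0⇒≡0 {xs = y ∷ _} {f} ∑≡0 (there x∈xs) = ∑ℕ≡0⇒≡0 (ℕ.m+n≡0⇒n≡0 (f y) ∑≡0) x∈xs

sum-filter : ∀ {a} {A : Set a} (b : A → Bool) (f : A → ℕ) (xs : List A) →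
             sum (map f (filter (λ x → b x ≟ᵇ true) xs)) ≡ ℕΣ.∑ xs (λ x → if b x then f x else 0)
sum-filter b f []       = refl
sum-filter b f (x ∷ xs) with b x
... | true  = cong (f x ℕ.+_) (sum-filter b f xs)
... | false = sum-filter b f xs

0ᵥ : ∀ {v} → Vect v
0ᵥ = replicate _ false

infixl 6 _⊕_
_⊕_ : ∀ {v} → Vect v → Vect v → Vect v
_⊕_ = zipWith _xor_

infixr 7 _·_
_·_ : ∀ {v} → ℕ → Vect v → Vect v
zero  · x = 0ᵥ
suc m · x = x ⊕ m · x

⊕-identityˡ : ∀ {v} (x : Vect v) → 0ᵥ ⊕ x ≡ x
⊕-identityˡ []      = refl
⊕-identityˡ (b ∷ x) = cong (b ∷_) (⊕-identityˡ x)

dot-comm : ∀ {v} (a x : Vect v) → dot a x ≡ dot x a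
dot-comm []      []      = refl
dot-comm (b ∷ a) (c ∷ x) = cong₂ _xor_ (∧-comm b c) (dot-comm a x)

dot-zeroʳ : ∀ {v} (a : Vect v) → dot a 0ᵥ ≡ false
dot-zeroʳ []          = refl
dot-zeroʳ (false ∷ a) = dot-zeroʳ a
dot-zeroʳ (true ∷ a)  = dot-zeroʳ a

nonzero≡false⇒dot≡false : ∀ {v} (a : Vect v) → nonzero a ≡ false → ∀ x → dot a x ≡ false
nonzero≡false⇒dot≡false []          _   []      = refl
nonzero≡false⇒dot≡false (false ∷ a) a≡0 (_ ∷ x) = nonzero≡false⇒dot≡false a a≡0 x

dot-⊕ʳ : ∀ {v} (a x y : Vect v) → dot a (x ⊕ y) ≡ dot a x xor dot a y
dot-⊕ʳ []      []      []      = refl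
dot-⊕ʳ (b ∷ a) (c ∷ x) (d ∷ y) = begin
  (b ∧ (c xor d)) xor dot a (x ⊕ y)             ≡⟨ cong₂ _xor_ (∧-distribˡ-xor b c d) (dot-⊕ʳ a x y) ⟩
  ((b ∧ c) xor (b ∧ d)) xor (dot a x xor dot a y) ≡⟨ xor-interchange (b ∧ c) (b ∧ d) _ _ ⟩
  ((b ∧ c) xor dot a x) xor ((b ∧ d) xor dot a y) ∎

allVecs-complete : ∀ {v} (x : Vect v) → x ∈ allVecs v
allVecs-complete []          = here refl
allVecs-complete (false ∷ x) = ∈-++⁺ˡ (∈-map⁺ (false ∷_) (allVecs-complete x))
allVecs-complete {suc v} (true ∷ x) = ∈-++⁺ʳ (map (false ∷_) (allVecs v)) (∈-map⁺ (true ∷_) (allVecs-complete x))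

⨁ : ∀ {v} → List (Vect v) → (Vect v → ℕ) → Vect v
⨁ []       f = 0ᵥ
⨁ (x ∷ xs) f = f x · x ⊕ ⨁ xs f

χ : ∀ {v} → Vect v → Vect v → ℤ
χ a x = if dot a x then -1ℤ else 1ℤ

χ-comm : ∀ {v} (a x : Vect v) → χ a x ≡ χ x a
χ-comm a x = cong (if_then -1ℤ else 1ℤ) (dot-comm a x)

χ-zeroˡ : ∀ {v} (x : Vect v) → χ 0ᵥ x ≡ 1ℤ
χ-zeroˡ x = trans (χ-comm 0ᵥ x) (cong (if_then -1ℤ else 1ℤ) (dot-zeroʳ x))

χ-⊕ʳ : ∀ {v} (a x y : Vect v) → χ a (x ⊕ y) ≡ χ a x * χ a y
χ-⊕ʳ a x y rewrite dot-⊕ʳ a x y with dot a x | dot a y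
... | false | false = refl
... | false | true  = refl
... | true  | false = refl
... | true  | true  = refl

χ-⊕ˡ : ∀ {v} (x y a : Vect v) → χ (x ⊕ y) a ≡ χ x a * χ y a
χ-⊕ˡ x y a = begin
  χ (x ⊕ y) a     ≡⟨ χ-comm (x ⊕ y) a ⟩
  χ a (x ⊕ y)     ≡⟨ χ-⊕ʳ a x y ⟩
  χ a x * χ a y   ≡⟨ cong₂ _*_ (χ-comm a x) (χ-comm a y) ⟩
  χ x a * χ y a   ∎

χ-·ʳ : ∀ {v} (a x : Vect v) (m : ℕ) → χ a (m · x) ≡ χ a x ℤ.^ m
χ-·ʳ a x zero    = trans (χ-comm a 0ᵥ) (χ-zeroˡ a)
χ-·ʳ a x (suc m) = trans (χ-⊕ʳ a x (m · x)) (cong (χ a x *_) (χ-·ʳ a x m))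

χ-not : ∀ b → (if not b then -1ℤ else 1ℤ) ≡ - (if b then -1ℤ else 1ℤ)
χ-not false = refl
χ-not true  = refl

χ-⨁ : ∀ {v} (a : Vect v) (xs : List (Vect v)) (f : Vect v → ℕ) →
      χ a (⨁ xs f) ≡ -1ℤ ℤ.^ ℕΣ.∑ xs (λ x → if dot a x then f x else 0)
χ-⨁ a []       f = trans (χ-comm a 0ᵥ) (χ-zeroˡ a)
χ-⨁ {v} a (x ∷ xs) f = begin
  χ a (f x · x ⊕ ⨁ xs f)                          ≡⟨ χ-⊕ʳ a (f x · x) (⨁ xs f) ⟩
  χ a (f x · x) * χ a (⨁ xs f)                    ≡⟨ cong₂ _*_ (trans (χ-·ʳ a x (f x)) (sign-power (dot a x))) (χ-⨁ a xs f) ⟩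
  -1ℤ ℤ.^ restrict x * -1ℤ ℤ.^ ℕΣ.∑ xs restrict   ≡⟨ ℤ.^-distribˡ-+-* -1ℤ (restrict x) _ ⟨
  -1ℤ ℤ.^ (restrict x ℕ.+ ℕΣ.∑ xs restrict)       ∎
  where
  restrict : Vect v → ℕ
  restrict y = if dot a y then f y else 0
  sign-power : ∀ b → (if b then -1ℤ else 1ℤ) ℤ.^ f x ≡ -1ℤ ℤ.^ (if b then f x else 0)
  sign-power true  = refl
  sign-power false = ℤ.^-zeroˡ (f x)

∑ᵥ : ∀ {v} → (Vect v → ℤ) → ℤ
∑ᵥ {v} = ∑ (allVecs v)

∑ᵥ-suc : ∀ {v} (f : Vect (suc v) → ℤ) → ∑ᵥ f ≡ ∑ᵥ (λ x → f (false ∷ x)) + ∑ᵥ (λ x → f (true ∷ x))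
∑ᵥ-suc {v} f = begin
  ∑ (map (false ∷_) (allVecs v) ++ map (true ∷_) (allVecs v)) f   ≡⟨ ∑-++ (map (false ∷_) (allVecs v)) _ f ⟩
  ∑ (map (false ∷_) (allVecs v)) f + ∑ (map (true ∷_) (allVecs v)) f
    ≡⟨ cong₂ _+_ (∑-map _ (allVecs v) f) (∑-map _ (allVecs v) f) ⟩
  ∑ᵥ (λ x → f (false ∷ x)) + ∑ᵥ (λ x → f (true ∷ x))               ∎

2ᵛc+2ᵛc≡2ᵛ⁺¹c : ∀ v (c : ℤ) → + (2 ^ v) * c + + (2 ^ v) * c ≡ + (2 ^ suc v) * c
2ᵛc+2ᵛc≡2ᵛ⁺¹c v c = trans (double (+ (2 ^ v)) c) (cong (_* c) (sym (ℤ.pos-* 2 (2 ^ v))))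
  where
  double : ∀ t c → t * c + t * c ≡ + 2 * t * c
  double = solve-∀

∑ᵥ-const : ∀ v (c : ℤ) → ∑ᵥ {v} (λ _ → c) ≡ + (2 ^ v) * c
∑ᵥ-const zero    c = trans (ℤ.+-identityʳ c) (sym (ℤ.*-identityˡ c))
∑ᵥ-const (suc v) c = begin
  ∑ᵥ {suc v} (λ _ → c)                ≡⟨ ∑ᵥ-suc {v} (λ _ → c) ⟩
  ∑ᵥ {v} (λ _ → c) + ∑ᵥ {v} (λ _ → c) ≡⟨ cong₂ _+_ (∑ᵥ-const v c) (∑ᵥ-const v c) ⟩
  + (2 ^ v) * c + + (2 ^ v) * c      ≡⟨ 2ᵛc+2ᵛc≡2ᵛ⁺¹c v c ⟩
  + (2 ^ suc v) * c                  ∎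

2ᵛ*neg≱0 : ∀ v j → ¬ (0ℤ ≤ + (2 ^ v) * ℤ.-[1+ j ])
2ᵛ*neg≱0 v j with 2 ^ v | ℕ.m^n>0 2 v
... | suc m | _ = λ ()

δ₀ : ∀ {v} → Vect v → ℤ
δ₀ x = if nonzero x then 0ℤ else 1ℤ

δ₀-nonNeg : ∀ {v} (x : Vect v) → 0ℤ ≤ δ₀ x
δ₀-nonNeg x with nonzero x
... | true  = +≤+ ℕ.z≤n
... | false = +≤+ ℕ.z≤n

orthogonality : ∀ v (x : Vect v) → ∑ᵥ (χ x) ≡ + (2 ^ v) * δ₀ x
orthogonality zero    []          = refl
orthogonality (suc v) (false ∷ x) = begin
  ∑ᵥ (χ (false ∷ x))                     ≡⟨ ∑ᵥ-suc {v} (χ (false ∷ x)) ⟩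
  ∑ᵥ (χ x) + ∑ᵥ (χ x)                    ≡⟨ cong₂ _+_ (orthogonality v x) (orthogonality v x) ⟩
  + (2 ^ v) * δ₀ x + + (2 ^ v) * δ₀ x    ≡⟨ 2ᵛc+2ᵛc≡2ᵛ⁺¹c v (δ₀ x) ⟩
  + (2 ^ suc v) * δ₀ x                   ∎
orthogonality (suc v) (true ∷ x)  = begin
  ∑ᵥ (χ (true ∷ x))                                        ≡⟨ ∑ᵥ-suc {v} (χ (true ∷ x)) ⟩
  ∑ᵥ (χ x) + ∑ᵥ (λ a → if not (dot x a) then -1ℤ else 1ℤ)
    ≡⟨ cong (_+_ (∑ᵥ (χ x))) (∑-cong (allVecs v) (λ a → χ-not (dot x a))) ⟩
  ∑ᵥ (χ x) + ∑ᵥ (λ a → - χ x a)                            ≡⟨ cong (_+_ (∑ᵥ (χ x))) (∑-neg (allVecs v) (χ x)) ⟩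
  ∑ᵥ (χ x) + - ∑ᵥ (χ x)                                    ≡⟨ ℤ.+-inverseʳ (∑ᵥ (χ x)) ⟩
  0ℤ                                                      ≡⟨ ℤ.*-zeroʳ (+ (2 ^ suc v)) ⟨
  + (2 ^ suc v) * 0ℤ                                      ∎

sifting : ∀ v (f : Vect v → ℤ) (x : Vect v) → ∑ᵥ (λ y → f y * δ₀ (x ⊕ y)) ≡ f x
sifting zero    f []          = trans (ℤ.+-identityʳ _) (ℤ.*-identityʳ (f []))
sifting (suc v) f (false ∷ x) = trans (∑ᵥ-suc {v} _) (begin
  ∑ᵥ (λ y → f (false ∷ y) * δ₀ (x ⊕ y)) + ∑ᵥ (λ y → f (true ∷ y) * 0ℤ)
    ≡⟨ cong₂ _+_ (sifting v (λ y → f (false ∷ y)) x) (∑-*-zeroʳ (allVecs v) (λ y → f (true ∷ y))) ⟩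
  f (false ∷ x) + 0ℤ                                                   ≡⟨ ℤ.+-identityʳ _ ⟩
  f (false ∷ x)                                                        ∎)
sifting (suc v) f (true ∷ x)  = trans (∑ᵥ-suc {v} _) (begin
  ∑ᵥ (λ y → f (false ∷ y) * 0ℤ) + ∑ᵥ (λ y → f (true ∷ y) * δ₀ (x ⊕ y))
    ≡⟨ cong₂ _+_ (∑-*-zeroʳ (allVecs v) (λ y → f (false ∷ y))) (sifting v (λ y → f (true ∷ y)) x) ⟩
  0ℤ + f (true ∷ x)                                                    ≡⟨ ℤ.+-identityˡ _ ⟩
  f (true ∷ x)                                                         ∎)

𝓕 : ∀ {v} → (Vect v → ℤ) → Vect v → ℤ
𝓕 f a = ∑ᵥ (λ x → χ a x * f x)

convolution : ∀ {v} (f H : Vect v → ℤ) (c : Vect v) →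
              𝓕 (λ a → 𝓕 f a * H a) c ≡ ∑ᵥ (λ x → f x * 𝓕 H (c ⊕ x))
convolution {v} f H c = begin
  ∑ᵥ (λ a → χ c a * (𝓕 f a * H a))                ≡⟨ ∑-cong (allVecs v) expand ⟩
  ∑ᵥ (λ a → ∑ᵥ (λ x → f x * (χ (c ⊕ x) a * H a))) ≡⟨ ∑-comm (allVecs v) (allVecs v) _ ⟩
  ∑ᵥ (λ x → ∑ᵥ (λ a → f x * (χ (c ⊕ x) a * H a))) ≡⟨ ∑-cong (allVecs v) (λ x → ∑-distribˡ-* (allVecs v) (f x) _) ⟩
  ∑ᵥ (λ x → f x * 𝓕 H (c ⊕ x))                     ∎
  where
  r₁ : ∀ p s h → p * (s * h) ≡ (p * h) * s
  r₁ = solve-∀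
  r₂ : ∀ p h q y → (p * h) * (q * y) ≡ y * ((p * q) * h)
  r₂ = solve-∀
  χ-merge : ∀ a x → χ c a * χ a x ≡ χ (c ⊕ x) a
  χ-merge a x = trans (cong (χ c a *_) (χ-comm a x)) (sym (χ-⊕ˡ c x a))
  expand : ∀ a → χ c a * (𝓕 f a * H a) ≡ ∑ᵥ (λ x → f x * (χ (c ⊕ x) a * H a))
  expand a = begin
    χ c a * (𝓕 f a * H a)                          ≡⟨ r₁ (χ c a) (𝓕 f a) (H a) ⟩
    (χ c a * H a) * 𝓕 f a                          ≡⟨ ∑-distribˡ-* (allVecs v) (χ c a * H a) _ ⟨
    ∑ᵥ (λ x → (χ c a * H a) * (χ a x * f x))       ≡⟨ ∑-cong (allVecs v) (λ x → r₂ (χ c a) (H a) (χ a x) (f x)) ⟩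
    ∑ᵥ (λ x → f x * ((χ c a * χ a x) * H a))       ≡⟨ ∑-cong (allVecs v) (λ x → cong (λ e → f x * (e * H a)) (χ-merge a x)) ⟩
    ∑ᵥ (λ x → f x * (χ (c ⊕ x) a * H a))           ∎

𝓕-one : ∀ {v} (c : Vect v) → 𝓕 (λ _ → 1ℤ) c ≡ + (2 ^ v) * δ₀ c
𝓕-one {v} c = trans (∑-cong (allVecs v) (λ a → ℤ.*-identityʳ (χ c a))) (orthogonality v c)

𝓕-at-zero : ∀ {v} (f : Vect v → ℤ) → 𝓕 f 0ᵥ ≡ ∑ᵥ f
𝓕-at-zero {v} f = ∑-cong (allVecs v) (λ x → trans (cong (_* f x) (χ-zeroˡ x)) (ℤ.*-identityˡ (f x)))

inversion : ∀ {v} (f : Vect v → ℤ) (c : Vect v) → 𝓕 (𝓕 f) c ≡ + (2 ^ v) * f c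
inversion {v} f c = begin
  𝓕 (𝓕 f) c                                         ≡⟨ ∑-cong (allVecs v) (λ a → cong (χ c a *_) (ℤ.*-identityʳ (𝓕 f a))) ⟨
  𝓕 (λ a → 𝓕 f a * 1ℤ) c                            ≡⟨ convolution f (λ _ → 1ℤ) c ⟩
  ∑ᵥ (λ x → f x * 𝓕 (λ _ → 1ℤ) (c ⊕ x))             ≡⟨ ∑-cong (allVecs v) (λ x → cong (f x *_) (𝓕-one (c ⊕ x))) ⟩
  ∑ᵥ (λ x → f x * (+ (2 ^ v) * δ₀ (c ⊕ x)))         ≡⟨ ∑-cong (allVecs v) (λ x → r (f x) (+ (2 ^ v)) _) ⟩
  ∑ᵥ (λ x → + (2 ^ v) * (f x * δ₀ (c ⊕ x)))         ≡⟨ ∑-distribˡ-* (allVecs v) (+ (2 ^ v)) _ ⟩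
  + (2 ^ v) * ∑ᵥ (λ x → f x * δ₀ (c ⊕ x))           ≡⟨ cong (+ (2 ^ v) *_) (sifting v f c) ⟩
  + (2 ^ v) * f c                                   ∎
  where
  r : ∀ y t d → y * (t * d) ≡ t * (y * d)
  r = solve-∀

parseval : ∀ {v} (f g : Vect v → ℤ) → ∑ᵥ (λ a → 𝓕 f a * 𝓕 g a) ≡ + (2 ^ v) * ∑ᵥ (λ x → f x * g x)
parseval {v} f g = begin
  ∑ᵥ (λ a → 𝓕 f a * 𝓕 g a)                 ≡⟨ 𝓕-at-zero (λ a → 𝓕 f a * 𝓕 g a) ⟨
  𝓕 (λ a → 𝓕 f a * 𝓕 g a) 0ᵥ               ≡⟨ convolution f (𝓕 g) 0ᵥ ⟩
  ∑ᵥ (λ x → f x * 𝓕 (𝓕 g) (0ᵥ ⊕ x))        ≡⟨ ∑-cong (allVecs v) (λ x → cong (λ y → f x * 𝓕 (𝓕 g) y) (⊕-identityˡ x)) ⟩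
  ∑ᵥ (λ x → f x * 𝓕 (𝓕 g) x)               ≡⟨ ∑-cong (allVecs v) (λ x → cong (f x *_) (inversion g x)) ⟩
  ∑ᵥ (λ x → f x * (+ (2 ^ v) * g x))       ≡⟨ ∑-cong (allVecs v) (λ x → r (f x) (+ (2 ^ v)) (g x)) ⟩
  ∑ᵥ (λ x → + (2 ^ v) * (f x * g x))       ≡⟨ ∑-distribˡ-* (allVecs v) (+ (2 ^ v)) _ ⟩
  + (2 ^ v) * ∑ᵥ (λ x → f x * g x)         ∎
  where
  r : ∀ y t d → y * (t * d) ≡ t * (y * d)
  r = solve-∀

PositiveDefinite : ∀ {v} → (Vect v → ℤ) → Set
PositiveDefinite H = ∀ c → 0ℤ ≤ 𝓕 H c

one-positiveDefinite : ∀ {v} → PositiveDefinite {v} (λ _ → 1ℤ)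
one-positiveDefinite {v} c = subst (0ℤ ≤_) (sym (𝓕-one c)) (*-nonNeg {+ (2 ^ v)} (+≤+ ℕ.z≤n) (δ₀-nonNeg c))

𝓕*-positiveDefinite : ∀ {v} (f H : Vect v → ℤ) → (∀ x → 0ℤ ≤ f x) →
                      PositiveDefinite H → PositiveDefinite (λ a → 𝓕 f a * H a)
𝓕*-positiveDefinite {v} f H f≥0 H-pd c = subst (0ℤ ≤_) (sym (convolution f H c))
  (∑-nonNeg (allVecs v) (λ x → *-nonNeg (f≥0 x) (H-pd (c ⊕ x))))

massOff : ∀ {v} → (Vect v → ℕ) → Vect v → ℕ
massOff {v} f a = ℕΣ.∑ (allVecs v) (λ x → if dot a x then f x else 0)

total : ∀ {v} → (Vect v → ℕ) → ℕ
total {v} f = ℕΣ.∑ (allVecs v) f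

𝓕-ℕ : ∀ {v} (f : Vect v → ℕ) (a : Vect v) → 𝓕 (λ x → + f x) a ≡ + total f - + 2 * + massOff f a
𝓕-ℕ {v} f a = begin
  ∑ᵥ (λ x → χ a x * + f x)                      ≡⟨ ∑-cong (allVecs v) split ⟩
  ∑ᵥ (λ x → + f x + - (+ 2 * + g x))            ≡⟨ ∑-distrib-+ (allVecs v) _ _ ⟩
  ∑ᵥ (λ x → + f x) + ∑ᵥ (λ x → - (+ 2 * + g x)) ≡⟨ cong (_+_ (∑ᵥ (λ x → + f x))) (∑-neg (allVecs v) _) ⟩
  ∑ᵥ (λ x → + f x) - ∑ᵥ (λ x → + 2 * + g x)
    ≡⟨ cong (λ e → ∑ᵥ (λ x → + f x) - e) (∑-distribˡ-* (allVecs v) (+ 2) _) ⟩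
  ∑ᵥ (λ x → + f x) - + 2 * ∑ᵥ (λ x → + g x)
    ≡⟨ cong₂ (λ s t → s - + 2 * t) (pos-∑ (allVecs v) f) (pos-∑ (allVecs v) g) ⟨
  + total f - + 2 * + massOff f a               ∎
  where
  g : Vect v → ℕ
  g x = if dot a x then f x else 0
  odd : ∀ y → -1ℤ * y ≡ y + - (+ 2 * y)
  odd = solve-∀
  even : ∀ y → 1ℤ * y ≡ y + - (+ 2 * 0ℤ)
  even = solve-∀
  split : ∀ x → χ a x * + f x ≡ + f x + - (+ 2 * + g x)
  split x with dot a x
  ... | true  = odd (+ f x)
  ... | false = even (+ f x)

𝓕-ℕ-at-zero : ∀ {v} (f : Vect v → ℕ) → 𝓕 (λ x → + f x) 0ᵥ ≡ + total f
𝓕-ℕ-at-zero {v} f = trans (𝓕-at-zero (λ x → + f x)) (sym (pos-∑ (allVecs v) f))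

parseval-01 : ∀ {v} (f : Vect v → ℕ) → (∀ x → f x ℕ.≤ 1) →
              ∑ᵥ (λ a → 𝓕 (λ x → + f x) a * 𝓕 (λ x → + f x) a) ≡ + (2 ^ v) * + total f
parseval-01 {v} f f≤1 = begin
  ∑ᵥ (λ a → 𝓕 (λ x → + f x) a * 𝓕 (λ x → + f x) a) ≡⟨ parseval (λ x → + f x) (λ x → + f x) ⟩
  + (2 ^ v) * ∑ᵥ (λ x → + f x * + f x)              ≡⟨ cong (+ (2 ^ v) *_) (∑-cong (allVecs v) (λ x → idempotent (f≤1 x))) ⟩
  + (2 ^ v) * ∑ᵥ (λ x → + f x)                      ≡⟨ cong (+ (2 ^ v) *_) (pos-∑ (allVecs v) f) ⟨
  + (2 ^ v) * + total f                             ∎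
  where
  idempotent : ∀ {m} → m ℕ.≤ 1 → + m * + m ≡ + m
  idempotent ℕ.z≤n           = refl
  idempotent (ℕ.s≤s ℕ.z≤n)   = refl

massOff≤total : ∀ {v} (f : Vect v → ℕ) (a : Vect v) → massOff f a ℕ.≤ total f
massOff≤total {v} f a = ∑ℕ-mono-≤ (allVecs v) restrict≤
  where
  restrict≤ : ∀ x → (if dot a x then f x else 0) ℕ.≤ f x
  restrict≤ x with dot a x
  ... | true  = ℕ.≤-refl
  ... | false = ℕ.z≤n

massOff-linear : ∀ {v} {f g h : Vect v → ℕ} (c : ℕ) → (∀ x → f x ≡ g x ℕ.+ c ℕ.* h x) →
                 ∀ a → massOff f a ≡ massOff g a ℕ.+ c ℕ.* massOff h a
massOff-linear {v} {f} {g} {h} c f≡ a = trans (ℕΣ.∑-cong (allVecs v) restrict) (trans (ℕΣ.∑-distrib-+ (allVecs v) _ _)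
  (cong (massOff g a ℕ.+_) (ℕΣ.∑-distribˡ-* (allVecs v) c _)))
  where
  restrict : ∀ x → (if dot a x then f x else 0) ≡
                   (if dot a x then g x else 0) ℕ.+ c ℕ.* (if dot a x then h x else 0)
  restrict x with dot a x
  ... | true  = f≡ x
  ... | false = sym (ℕ.*-zeroʳ c)

total-linear : ∀ {v} {f g h : Vect v → ℕ} (c : ℕ) → (∀ x → f x ≡ g x ℕ.+ c ℕ.* h x) →
               total f ≡ total g ℕ.+ c ℕ.* total h
total-linear {v} {f} {g} {h} c f≡ = trans (ℕΣ.∑-cong (allVecs v) f≡)
  (trans (ℕΣ.∑-distrib-+ (allVecs v) _ _) (cong (total g ℕ.+_) (ℕΣ.∑-distribˡ-* (allVecs v) c h)))

massOff-nonpoint : ∀ {v} (f : Vect v → ℕ) (a : Vect v) → nonzero a ≡ false → massOff f a ≡ 0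
massOff-nonpoint {v} f a a≡0 =
  trans (ℕΣ.∑-cong (allVecs v) (λ x → cong (if_then f x else 0) (nonzero≡false⇒dot≡false a a≡0 x))) (ℕΣ.∑-zero (allVecs v))

∀-box : {P : ℕ → ℕ → Set} (P? : ∀ p q → Dec (P p q)) {N K : ℕ} →
        True (all? λ (i : Fin (suc N)) → all? λ (j : Fin (suc K)) → P? (toℕ i) (toℕ j)) →
        ∀ {p q} → p ℕ.≤ N → q ℕ.≤ K → P p q
∀-box {P} P? ok p≤N q≤K =
  subst₂ P (toℕ-fromℕ< (ℕ.s≤s p≤N)) (toℕ-fromℕ< (ℕ.s≤s q≤K)) (toWitness ok (fromℕ< _) (fromℕ< _))

admissible? : ∀ {C : ℤ → ℤ → ℤ → Set} → (∀ s t σ → Dec (C s t σ)) → (N K p q : ℕ) →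
              Dec (4 ∣ p ℕ.+ 2 ℕ.* q → C (+ N - + 2 * + p) (+ K - + 2 * + q) (-1ℤ ℤ.^ q))
admissible? C? N K p q = (4 ∣? p ℕ.+ 2 ℕ.* q) →-dec C? _ _ _

module Layers {v : ℕ} (A B : Vect v → ℕ) (A≤1 : ∀ x → A x ℕ.≤ 1) (B≤1 : ∀ x → B x ℕ.≤ 1)
              (divisible : ∀ a → 4 ∣ massOff A a ℕ.+ 2 ℕ.* massOff B a) where

  β : Vect v
  β = ⨁ (allVecs v) B

  s t σ : Vect v → ℤ
  s = 𝓕 (λ x → + A x)
  t = 𝓕 (λ x → + B x)
  σ a = χ a β

  -- By 𝓕-ℕ and χ-⨁, s a = n − 2p, t a = k − 2q and σ a = (−1)^q for the masses p ≤ n, q ≤ k of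
  -- A, B off a⊥, with 4 ∣ p + 2q; so a claim about these three numbers is checked on a finite box.
  pointwise : ∀ {N K} {C : ℤ → ℤ → ℤ → Set} (C? : ∀ s t σ → Dec (C s t σ)) →
              total A ≡ N → total B ≡ K →
              {_ : True (all? λ (i : Fin (suc N)) → all? λ (j : Fin (suc K)) → admissible? C? N K (toℕ i) (toℕ j))} →
              ∀ a → C (s a) (t a) (σ a)
  pointwise C? refl refl {ok} a
    rewrite 𝓕-ℕ A a | 𝓕-ℕ B a | χ-⨁ a (allVecs v) B
    = ∀-box (admissible? C? _ _) ok (massOff≤total A a) (massOff≤total B a) (divisible a)

  ∑s² : ∀ {N} → total A ≡ N → ∑ᵥ (λ a → s a * s a) ≡ + (2 ^ v) * + N
  ∑s² refl = parseval-01 A A≤1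

  ∑t² : ∀ {K} → total B ≡ K → ∑ᵥ (λ a → t a * t a) ≡ + (2 ^ v) * + K
  ∑t² refl = parseval-01 B B≤1

  ∑σs : ∑ᵥ (λ a → σ a * s a) ≡ + (2 ^ v) * + A β
  ∑σs = trans (∑-cong (allVecs v) (λ a → cong (_* s a) (χ-comm a β))) (inversion (λ x → + A x) β)

  ∑σs≥0 : 0ℤ ≤ ∑ᵥ (λ a → σ a * s a)
  ∑σs≥0 = subst (0ℤ ≤_) (sym ∑σs) (*-nonNeg {+ (2 ^ v)} {+ A β} (+≤+ ℕ.z≤n) (+≤+ ℕ.z≤n))

  ∑σ≥0 : 0ℤ ≤ ∑ᵥ σ
  ∑σ≥0 = subst (0ℤ ≤_) (∑-cong (allVecs v) (λ a → trans (ℤ.*-identityʳ (χ β a)) (χ-comm β a)))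
                (one-positiveDefinite β)

  ∑σs³≥0 : 0ℤ ≤ ∑ᵥ (λ a → σ a * (s a * (s a * s a)))
  ∑σs³≥0 = subst (0ℤ ≤_) (∑-cong (allVecs v) rearrange) (cube-pd β)
    where
    A≥0 : ∀ x → 0ℤ ≤ + A x
    A≥0 x = +≤+ ℕ.z≤n
    cube-pd : PositiveDefinite (λ a → s a * (s a * (s a * 1ℤ)))
    cube-pd = 𝓕*-positiveDefinite _ _ A≥0 (𝓕*-positiveDefinite _ _ A≥0
                (𝓕*-positiveDefinite _ _ A≥0 one-positiveDefinite))
    rearrange : ∀ a → χ β a * (s a * (s a * (s a * 1ℤ))) ≡ σ a * (s a * (s a * s a))
    rearrange a = cong₂ _*_ (χ-comm β a) (cong (λ e → s a * (s a * e)) (ℤ.*-identityʳ (s a)))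

  k≢0 : total A ≡ 12 → total B ≡ 0 → ⊥
  k≢0 hA hB = 2ᵛ*neg≱0 v 3 (subst (0ℤ ≤_) total-excess (∑-nonNeg (allVecs v) excess≥0))
    where
    excess≥0 : ∀ a → 0ℤ ≤ s a * s a + ℤ.-[1+ 15 ]
    excess≥0 = pointwise (λ s _ _ → 0ℤ ℤ.≤? s * s + ℤ.-[1+ 15 ]) hA hB
    r : ∀ T → T * + 12 + T * ℤ.-[1+ 15 ] ≡ T * ℤ.-[1+ 3 ]
    r = solve-∀
    total-excess : ∑ᵥ (λ a → s a * s a + ℤ.-[1+ 15 ]) ≡ + (2 ^ v) * ℤ.-[1+ 3 ]
    total-excess = begin
      ∑ᵥ (λ a → s a * s a + ℤ.-[1+ 15 ])                 ≡⟨ ∑-distrib-+ (allVecs v) _ _ ⟩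
      ∑ᵥ (λ a → s a * s a) + ∑ᵥ {v} (λ _ → ℤ.-[1+ 15 ]) ≡⟨ cong₂ _+_ (∑s² hA) (∑ᵥ-const v _) ⟩
      + (2 ^ v) * + 12 + + (2 ^ v) * ℤ.-[1+ 15 ]         ≡⟨ r (+ (2 ^ v)) ⟩
      + (2 ^ v) * ℤ.-[1+ 3 ]                             ∎

  k≢1 : total A ≡ 10 → total B ≡ 1 → ⊥
  k≢1 hA hB = excluded (A≤1 β) (subst (0ℤ ≤_) third-moment ∑σs³≥0)
    where
    identity : ∀ a → σ a * (s a * (s a * s a)) ≡ + 6 * (s a * s a) + (+ 52 * (σ a * s a) + ℤ.-[1+ 119 ])
    identity = pointwise (λ s _ σ → σ * (s * (s * s)) ℤ.≟ + 6 * (s * s) + (+ 52 * (σ * s) + ℤ.-[1+ 119 ])) hA hB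
    third-moment : ∑ᵥ (λ a → σ a * (s a * (s a * s a))) ≡
                   + 6 * (+ (2 ^ v) * + 10) + (+ 52 * (+ (2 ^ v) * + A β) + + (2 ^ v) * ℤ.-[1+ 119 ])
    third-moment = begin
      ∑ᵥ (λ a → σ a * (s a * (s a * s a)))                                  ≡⟨ ∑-cong (allVecs v) identity ⟩
      ∑ᵥ (λ a → + 6 * (s a * s a) + (+ 52 * (σ a * s a) + ℤ.-[1+ 119 ]))    ≡⟨ ∑-linear (allVecs v) (+ 6) _ _ ⟩
      + 6 * ∑ᵥ (λ a → s a * s a) + ∑ᵥ (λ a → + 52 * (σ a * s a) + ℤ.-[1+ 119 ])
        ≡⟨ cong₂ (λ x y → + 6 * x + y) (∑s² hA) (∑-linear (allVecs v) (+ 52) _ _) ⟩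
      + 6 * (+ (2 ^ v) * + 10) + (+ 52 * ∑ᵥ (λ a → σ a * s a) + ∑ᵥ {v} (λ _ → ℤ.-[1+ 119 ]))
        ≡⟨ cong₂ (λ x y → + 6 * (+ (2 ^ v) * + 10) + (+ 52 * x + y)) ∑σs (∑ᵥ-const v _) ⟩
      + 6 * (+ (2 ^ v) * + 10) + (+ 52 * (+ (2 ^ v) * + A β) + + (2 ^ v) * ℤ.-[1+ 119 ]) ∎
    r₀ : ∀ T → + 6 * (T * + 10) + (+ 52 * (T * + 0) + T * ℤ.-[1+ 119 ]) ≡ T * ℤ.-[1+ 59 ]
    r₀ = solve-∀
    r₁ : ∀ T → + 6 * (T * + 10) + (+ 52 * (T * + 1) + T * ℤ.-[1+ 119 ]) ≡ T * ℤ.-[1+ 7 ]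
    r₁ = solve-∀
    excluded : ∀ {m} → m ℕ.≤ 1 →
               ¬ (0ℤ ≤ + 6 * (+ (2 ^ v) * + 10) + (+ 52 * (+ (2 ^ v) * + m) + + (2 ^ v) * ℤ.-[1+ 119 ]))
    excluded ℕ.z≤n         = 2ᵛ*neg≱0 v 59 ∘ subst (0ℤ ≤_) (r₀ (+ (2 ^ v)))
    excluded (ℕ.s≤s ℕ.z≤n) = 2ᵛ*neg≱0 v 7 ∘ subst (0ℤ ≤_) (r₁ (+ (2 ^ v)))

  k≢2 : total A ≡ 8 → total B ≡ 2 → ⊥
  k≢2 hA hB = 64≰0 (subst₂ _≤_ excess-at-zero total-excess (term≤∑ (allVecs-complete 0ᵥ) excess≥0))
    where
    excess : Vect v → ℤ
    excess a = s a * s a + (+ 4 * (t a * t a) + ℤ.-[1+ 15 ])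
    excess≥0 : ∀ a → 0ℤ ≤ excess a
    excess≥0 = pointwise (λ s t _ → 0ℤ ℤ.≤? s * s + (+ 4 * (t * t) + ℤ.-[1+ 15 ])) hA hB
    r : ∀ T → T * + 8 + (+ 4 * (T * + 2) + T * ℤ.-[1+ 15 ]) ≡ 0ℤ
    r = solve-∀
    excess-at-zero : excess 0ᵥ ≡ + 64
    excess-at-zero = cong₂ (λ x y → x * x + (+ 4 * (y * y) + ℤ.-[1+ 15 ])) (trans (𝓕-ℕ-at-zero A) (cong +_ hA))
                       (trans (𝓕-ℕ-at-zero B) (cong +_ hB))
    total-excess : ∑ᵥ excess ≡ 0ℤ
    total-excess = begin
      ∑ᵥ excess                                                              ≡⟨ ∑-distrib-+ (allVecs v) _ _ ⟩
      ∑ᵥ (λ a → s a * s a) + ∑ᵥ (λ a → + 4 * (t a * t a) + ℤ.-[1+ 15 ])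
        ≡⟨ cong (_+_ (∑ᵥ (λ a → s a * s a))) (∑-linear (allVecs v) (+ 4) (λ a → t a * t a) _) ⟩
      ∑ᵥ (λ a → s a * s a) + (+ 4 * ∑ᵥ (λ a → t a * t a) + ∑ᵥ {v} (λ _ → ℤ.-[1+ 15 ]))
        ≡⟨ cong₂ (λ x y → x + (+ 4 * y + _)) (∑s² hA) (∑t² hB) ⟩
      + (2 ^ v) * + 8 + (+ 4 * (+ (2 ^ v) * + 2) + ∑ᵥ {v} (λ _ → ℤ.-[1+ 15 ]))
        ≡⟨ cong (λ y → + (2 ^ v) * + 8 + (+ 4 * (+ (2 ^ v) * + 2) + y)) (∑ᵥ-const v _) ⟩
      + (2 ^ v) * + 8 + (+ 4 * (+ (2 ^ v) * + 2) + + (2 ^ v) * ℤ.-[1+ 15 ]) ≡⟨ r (+ (2 ^ v)) ⟩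
      0ℤ                                                                     ∎
    64≰0 : ¬ (+ 64 ≤ 0ℤ)
    64≰0 (+≤+ ())

  k≢3 : total A ≡ 6 → total B ≡ 3 → ⊥
  k≢3 hA hB = 2ᵛ*neg≱0 v 5 (subst (0ℤ ≤_) first-moment (*-nonNeg {+ 4} (+≤+ ℕ.z≤n) ∑σs≥0))
    where
    identity : ∀ a → s a * s a + ℤ.-[1+ 11 ] ≡ + 4 * (σ a * s a)
    identity = pointwise (λ s _ σ → s * s + ℤ.-[1+ 11 ] ℤ.≟ + 4 * (σ * s)) hA hB
    r : ∀ T → T * + 6 + T * ℤ.-[1+ 11 ] ≡ T * ℤ.-[1+ 5 ]
    r = solve-∀
    first-moment : + 4 * ∑ᵥ (λ a → σ a * s a) ≡ + (2 ^ v) * ℤ.-[1+ 5 ]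
    first-moment = begin
      + 4 * ∑ᵥ (λ a → σ a * s a)                         ≡⟨ ∑-distribˡ-* (allVecs v) (+ 4) _ ⟨
      ∑ᵥ (λ a → + 4 * (σ a * s a))                       ≡⟨ ∑-cong (allVecs v) identity ⟨
      ∑ᵥ (λ a → s a * s a + ℤ.-[1+ 11 ])                 ≡⟨ ∑-distrib-+ (allVecs v) _ _ ⟩
      ∑ᵥ (λ a → s a * s a) + ∑ᵥ {v} (λ _ → ℤ.-[1+ 11 ])  ≡⟨ cong₂ _+_ (∑s² hA) (∑ᵥ-const v _) ⟩
      + (2 ^ v) * + 6 + + (2 ^ v) * ℤ.-[1+ 11 ]          ≡⟨ r (+ (2 ^ v)) ⟩
      + (2 ^ v) * ℤ.-[1+ 5 ]                             ∎

  k≢4 : total A ≡ 4 → total B ≡ 4 → ⊥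
  k≢4 hA hB = 2ᵛ*neg≱0 v 3 (subst (0ℤ ≤_) zeroth-moment (*-nonNeg {+ 8} (+≤+ ℕ.z≤n) ∑σ≥0))
    where
    identity : ∀ a → s a * s a ≡ + 8 * σ a + + 8
    identity = pointwise (λ s _ σ → s * s ℤ.≟ + 8 * σ + + 8) hA hB
    r₁ : ∀ x T → x ≡ (x + T * + 8) + T * ℤ.-[1+ 7 ]
    r₁ = solve-∀
    r₂ : ∀ T → T * + 4 + T * ℤ.-[1+ 7 ] ≡ T * ℤ.-[1+ 3 ]
    r₂ = solve-∀
    second-moment : + (2 ^ v) * + 4 ≡ + 8 * ∑ᵥ σ + + (2 ^ v) * + 8
    second-moment = begin
      + (2 ^ v) * + 4                   ≡⟨ ∑s² hA ⟨
      ∑ᵥ (λ a → s a * s a)              ≡⟨ ∑-cong (allVecs v) identity ⟩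
      ∑ᵥ (λ a → + 8 * σ a + + 8)        ≡⟨ ∑-linear (allVecs v) (+ 8) σ _ ⟩
      + 8 * ∑ᵥ σ + ∑ᵥ {v} (λ _ → + 8)   ≡⟨ cong (_+_ (+ 8 * ∑ᵥ σ)) (∑ᵥ-const v _) ⟩
      + 8 * ∑ᵥ σ + + (2 ^ v) * + 8      ∎
    zeroth-moment : + 8 * ∑ᵥ σ ≡ + (2 ^ v) * ℤ.-[1+ 3 ]
    zeroth-moment = begin
      + 8 * ∑ᵥ σ                                            ≡⟨ r₁ (+ 8 * ∑ᵥ σ) (+ (2 ^ v)) ⟩
      (+ 8 * ∑ᵥ σ + + (2 ^ v) * + 8) + + (2 ^ v) * ℤ.-[1+ 7 ] ≡⟨ cong (_+ + (2 ^ v) * ℤ.-[1+ 7 ]) second-moment ⟨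
      + (2 ^ v) * + 4 + + (2 ^ v) * ℤ.-[1+ 7 ]              ≡⟨ r₂ (+ (2 ^ v)) ⟩
      + (2 ^ v) * ℤ.-[1+ 3 ]                                ∎

  k≢5 : total A ≡ 2 → total B ≡ 5 → ⊥
  k≢5 hA hB = 2ᵛ*neg≱0 v 1 (subst (0ℤ ≤_) vanishing ℤ.≤-refl)
    where
    identity : ∀ a → s a * s a ≡ + 4
    identity = pointwise (λ s _ _ → s * s ℤ.≟ + 4) hA hB
    r₁ : ∀ T → 0ℤ ≡ T * + 4 + T * ℤ.-[1+ 3 ]
    r₁ = solve-∀
    r₂ : ∀ T → T * + 2 + T * ℤ.-[1+ 3 ] ≡ T * ℤ.-[1+ 1 ]
    r₂ = solve-∀
    second-moment : + (2 ^ v) * + 4 ≡ + (2 ^ v) * + 2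
    second-moment = begin
      + (2 ^ v) * + 4         ≡⟨ ∑ᵥ-const v _ ⟨
      ∑ᵥ {v} (λ _ → + 4)      ≡⟨ ∑-cong (allVecs v) identity ⟨
      ∑ᵥ (λ a → s a * s a)    ≡⟨ ∑s² hA ⟩
      + (2 ^ v) * + 2         ∎
    vanishing : 0ℤ ≡ + (2 ^ v) * ℤ.-[1+ 1 ]
    vanishing = trans (r₁ (+ (2 ^ v))) (trans (cong (_+ + (2 ^ v) * ℤ.-[1+ 3 ]) second-moment) (r₂ (+ (2 ^ v))))

  odd-part-vanishes : total A ℕ.+ 2 ℕ.* total B ≡ 12 → total A ≡ 0
  odd-part-vanishes n+2k≡12 = by-weight (total B) refl k≤6
    where
    n≡ : ∀ K → total B ≡ K → total A ≡ 12 ℕ.∸ 2 ℕ.* K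
    n≡ K refl = trans (sym (ℕ.m+n∸n≡m (total A) (2 ℕ.* K))) (cong (ℕ._∸ 2 ℕ.* K) n+2k≡12)
    k≤6 : total B ℕ.≤ 6
    k≤6 = ℕ.*-cancelˡ-≤ 2 (subst (2 ℕ.* total B ℕ.≤_) n+2k≡12 (ℕ.m≤n+m _ (total A)))
    by-weight : ∀ K → total B ≡ K → K ℕ.≤ 6 → total A ≡ 0
    by-weight 0 hB _ = ⊥-elim (k≢0 (n≡ 0 hB) hB)
    by-weight 1 hB _ = ⊥-elim (k≢1 (n≡ 1 hB) hB)
    by-weight 2 hB _ = ⊥-elim (k≢2 (n≡ 2 hB) hB)
    by-weight 3 hB _ = ⊥-elim (k≢3 (n≡ 3 hB) hB)
    by-weight 4 hB _ = ⊥-elim (k≢4 (n≡ 4 hB) hB)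
    by-weight 5 hB _ = ⊥-elim (k≢5 (n≡ 5 hB) hB)
    by-weight 6 hB _ = n≡ 6 hB
    by-weight (suc (suc (suc (suc (suc (suc (suc _))))))) _ (ℕ.s≤s (ℕ.s≤s (ℕ.s≤s (ℕ.s≤s (ℕ.s≤s (ℕ.s≤s ()))))))

-- A multiset carries a junk multiplicity at the zero vector, which is not a point; pointMass drops it.
pointMass : ∀ {v} → Multiset v → Vect v → ℕ
pointMass M x = if nonzero x then M x else 0

card≡total : ∀ {v} (M : Multiset v) → card M ≡ total (pointMass M)
card≡total {v} M = sum-filter nonzero M (allVecs v)

card-split : ∀ {v} (M : Multiset v) (a : Vect v) → card M ≡ hypMass M a ℕ.+ massOff (pointMass M) a
card-split {v} M a = begin
  card M                                        ≡⟨ card≡total M ⟩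
  total (pointMass M)                           ≡⟨ ℕΣ.∑-cong (allVecs v) split ⟩
  ℕΣ.∑ (allVecs v) (λ x → inHyperplane x ℕ.+ (if dot a x then pointMass M x else 0))
                                                ≡⟨ ℕΣ.∑-distrib-+ (allVecs v) inHyperplane _ ⟩
  ℕΣ.∑ (allVecs v) inHyperplane ℕ.+ massOff (pointMass M) a
                                                ≡⟨ cong (ℕ._+ massOff (pointMass M) a) (sum-filter _ M (allVecs v)) ⟨
  hypMass M a ℕ.+ massOff (pointMass M) a       ∎
  where
  inHyperplane : Vect v → ℕ
  inHyperplane x = if nonzero x ∧ not (dot a x) then M x else 0
  split : ∀ x → (if nonzero x then M x else 0) ≡
                (if nonzero x ∧ not (dot a x) then M x else 0) ℕ.+ (if dot a x then pointMass M x else 0)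
  split x with nonzero x | dot a x
  ... | true  | true  = refl
  ... | true  | false = sym (ℕ.+-identityʳ (M x))
  ... | false | true  = refl
  ... | false | false = refl

massOff-divisible : ∀ {v} (M : Multiset v) → Divisible 4 M → card M ≡ 12 → ∀ a → 4 ∣ massOff (pointMass M) a
massOff-divisible M div card≡12 a with nonzero a in isPoint
... | true  = ∣m+n∣m⇒∣n (subst (4 ∣_) (card-split M a) 4∣card) 4∣hyperplane
  where
  4∣card : 4 ∣ card M
  4∣card = subst (4 ∣_) (sym card≡12) (divides 3 refl)
  4∣hyperplane : 4 ∣ hypMass M a
  4∣hyperplane = m%n≡0⇒n∣m _ 4 (trans (div a isPoint) (cong (_% 4) card≡12))
... | false = subst (4 ∣_) (sym (massOff-nonpoint (pointMass M) a isPoint)) (4 ∣0)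

oddPart halfPart : ∀ {v} → Multiset v → Vect v → ℕ
oddPart M x = pointMass M x % 2
halfPart M x = pointMass M x / 2

pointMass≡odd+2half : ∀ {v} (M : Multiset v) x → pointMass M x ≡ oddPart M x ℕ.+ 2 ℕ.* halfPart M x
pointMass≡odd+2half M x = trans (m≡m%n+[m/n]*n (pointMass M x) 2) (cong (oddPart M x ℕ.+_) (ℕ.*-comm (halfPart M x) 2))

light-even : ∀ {v} (M : Multiset v) → Divisible 4 M → card M ≡ 12 → (∀ x → pointMass M x ℕ.≤ 3) →
             ∀ P → IsPoint P → Even (M P)
light-even M div card≡12 light P isPoint =
  subst (λ m → m % 2 ≡ 0) (cong (if_then M P else 0) isPoint)
        (∑ℕ≡0⇒≡0 (odd-part-vanishes weight) (allVecs-complete P))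
  where
  odd≤1 : ∀ x → oddPart M x ℕ.≤ 1
  odd≤1 x = ℕ.≤-pred (m%n<n (pointMass M x) 2)
  half≤1 : ∀ x → halfPart M x ℕ.≤ 1
  half≤1 x = /-monoˡ-≤ 2 (light x)
  divisible : ∀ a → 4 ∣ massOff (oddPart M) a ℕ.+ 2 ℕ.* massOff (halfPart M) a
  divisible a = subst (4 ∣_) (massOff-linear 2 (pointMass≡odd+2half M) a) (massOff-divisible M div card≡12 a)
  open Layers (oddPart M) (halfPart M) odd≤1 half≤1 divisible
  weight : total (oddPart M) ℕ.+ 2 ℕ.* total (halfPart M) ≡ 12
  weight = trans (sym (total-linear 2 (pointMass≡odd+2half M))) (trans (sym (card≡total M)) card≡12)

heavy-or-light : ∀ {v} (M : Multiset v) →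
                 Σ (Vect v) (λ P → IsPoint P × M P ≥ 4) ⊎ (∀ x → pointMass M x ℕ.≤ 3)
heavy-or-light {v} M with Any.any? (λ x → (nonzero x ≟ᵇ true) ×-dec (4 ℕ.≤? M x)) (allVecs v)
... | yes heavy  = inj₁ (Any.satisfied heavy)
... | no  ¬heavy = inj₂ light
  where
  light : ∀ x → (if nonzero x then M x else 0) ℕ.≤ 3
  light x with nonzero x in isPoint
  ... | true  = ℕ.≤-pred (ℕ.≰⇒> λ 4≤M → ¬heavy (lose (allVecs-complete x) (isPoint , 4≤M)))
  ... | false = ℕ.z≤n

proposition23 : (v : ℕ) (M : Multiset v) → Divisible 4 M → card M ≡ 12 →
    Σ (Vect v) (λ P → IsPoint P × M P ≥ 4) ⊎ ((P : Vect v) → IsPoint P → Even (M P))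
proposition23 v M div card≡12 = map₂ (light-even M div card≡12) (heavy-or-light M)
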